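{- Let $T$ be an in-quadrangular tournament and let $v\in V(T)$. Let $W$ be the subtournament of $T$ induced on the vertex set $I(v)$. Then $W$ contains no vertex of in-degree $1$ (in-degree computed in $W$).
   Context: A tournament $T$ is a loopless digraph in which for each pair of distinct vertices exactly one of $(u,v)$, $(v,u)$ is an arc; $u\rightarrow v$ means $(u,v)$ is an arc. $I(v)=\{u:u\rightarrow v\}$. A digraph is in-quadrangular if $|I(u)\cap I(v)|\neq 1$ for all distinct vertices $u,v$. -}

module Defs where

open import Data.Nat using (ℕ)
open import Data.Fin using (Fin)
open import Data.List using (List; length; filter)
open import Data.List using () renaming (allFin to allFinL)
open import Data.Product using (_×_; _,_)
open import Data.Sum using (_⊎_)
open import Relation.Nullary using (¬_; Dec)
open import Relation.Nullary.Decidable using (_×-dec_)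
open import Relation.Unary using (Pred; Decidable)
open import Relation.Binary.PropositionalEquality using (_≡_)
open import Level using (0ℓ)

record Digraph (n : ℕ) : Set₁ where
  field
    _⇒_  : Fin n → Fin n → Set
    _⇒?_ : (u v : Fin n) → Dec (u ⇒ v)

open Digraph public

count : {n : ℕ} {P : Pred (Fin n) 0ℓ} → Decidable P → ℕ
count {n} P? = length (filter P? (allFinL n))

IsTournament : {n : ℕ} → Digraph n → Set
IsTournament {n} D =
  (∀ u → ¬ (_⇒_ D u u)) ×
  (∀ u v → ¬ (u ≡ v) → (_⇒_ D u v ⊎ _⇒_ D v u)) ×
  (∀ u v → _⇒_ D u v → ¬ (_⇒_ D v u))

commonIn : {n : ℕ} → Digraph n → Fin n → Fin n → ℕ
commonIn D u v = count (λ w → _⇒?_ D w u ×-dec _⇒?_ D w v)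

InQuadrangular : {n : ℕ} → Digraph n → Set
InQuadrangular D = ∀ u v → ¬ (u ≡ v) → ¬ (commonIn D u v ≡ 1)

-- In-degree of x in the subtournament W induced on I(v) (meaningful for x ∈ I(v)):
-- the number of w ∈ I(v) with w ⇒ x.
inDegInSub : {n : ℕ} → (D : Digraph n) → (v x : Fin n) → ℕ
inDegInSub D v x = count (λ w → _⇒?_ D w v ×-dec _⇒?_ D w x)

{-# OPTIONS --safe #-}
module Submission where

open import Defs
open import Data.Nat using (ℕ)
open import Data.Fin using (Fin)
open import Data.Product using (_,_)
open import Relation.Nullary using (¬_)
open import Relation.Binary.PropositionalEquality using (_≡_; refl)

arc-endpoints-distinct : {n : ℕ} (D : Digraph n) → (∀ u → ¬ (_⇒_ D u u)) →
  ∀ {u v} → _⇒_ D u v → ¬ (v ≡ u)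
arc-endpoints-distinct D loopless u⇒v refl = loopless _ u⇒v

-- The in-degree of x in the subtournament on I(v) is |I(v) ∩ I(x)|, definitionally.
theorem10 : {n : ℕ} (T : Digraph n) → IsTournament T → InQuadrangular T →
    (v x : Fin n) → _⇒_ T x v → ¬ (inDegInSub T v x ≡ 1)
theorem10 T (loopless , _) inQuadrangular v x x⇒v =
  inQuadrangular v x (arc-endpoints-distinct T loopless x⇒v)
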